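{- Let $d,k\ge 1$ and $n\ge0$ be integers, and let $\overline{M[d]}^+_k(n)$ denote the $k$th positive moment of the $d$th residual crank of overpartitions of $n$ (defined in the context). Then $$\overline{M[d]}^+_k(n)\le \overline{M[d]}^+_{k+1}(n),$$ with equality if and only if $n<2d$.
   Context: An overpartition of $n$ is a non-increasing sequence of positive integers summing to $n$ in which the first occurrence of each distinct part value may be overlined. For an ordinary partition $\mu$, let $\omega(\mu)$ be the number of parts equal to $1$; the crank $cr(\mu)$ is the largest part of $\mu$ if $\omega(\mu)=0$ (with $cr(\emptyset)=0$), and otherwise is the number of parts of $\mu$ exceeding $\omega(\mu)$ minus $\omega(\mu)$. Following the Andrews–Garvan convention, define weights $c_m(\mu)$ for $m\in\mathbb Z$: if $\mu\ne(1)$ then $c_m(\mu)=1$ if $cr(\mu)=m$ and $0$ otherwise; for $\mu=(1)$ set $c_1=c_{ -1}=1$, $c_0=-1$, and $c_m=0$ for other $m$. For an overpartition $\lambda$ and integer $d\ge1$, let $\lambda'$ be the partition formed by the non-overlined parts of $\lambda$ that are divisible by $d$, each divided by $d$; the $d$th residual crank of $\lambda$ is $cr(\lambda')$. Set $\overline{M[d]}(m,n)=\sum_{\lambda} c_m(\lambda')$, the sum over all overpartitions $\lambda$ of $n$, and define the $k$th positive moment $\overline{M[d]}^+_k(n)=\sum_{m\ge1} m^k\,\overline{M[d]}(m,n)$. -}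

module Defs where

open import Data.Nat using (ℕ; zero; suc; _+_; _*_; _∸_; _≤ᵇ_; _<ᵇ_; _≡ᵇ_; NonZero)
open import Data.Nat.DivMod using (_/_; _%_)
open import Data.Bool using (Bool; true; false; if_then_else_)
open import Data.List using (List; []; _∷_; _++_; map; concatMap; filter; replicate; length; upTo; foldr)
open import Data.Product using (_×_; _,_)
open import Data.Integer as ℤ using (ℤ; +_)

-- An overpartition is a list of (part, overlined?) pairs, parts listed in
-- non-increasing order; only the first occurrence of a value may be overlined.
Overpartition : Set
Overpartition = List (ℕ × Bool)

blocks : ℕ → ℕ → List (List (ℕ × Bool))
blocks s zero    = [] ∷ []
blocks s (suc j) = ((s , true) ∷ replicate j (s , false)) ∷ replicate (suc j) (s , false) ∷ []

overpartitionsMax : ℕ → ℕ → List Overpartition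
overpartitionsMax n zero    = if n ≡ᵇ 0 then [] ∷ [] else []
overpartitionsMax n (suc s) =
  concatMap
    (λ j → if j * suc s ≤ᵇ n
             then concatMap (λ b → map (b ++_) (overpartitionsMax (n ∸ j * suc s) s)) (blocks (suc s) j)
             else [])
    (upTo (suc n))

overpartitions : ℕ → List Overpartition
overpartitions n = overpartitionsMax n n

Partition : Set
Partition = List ℕ

count : (ℕ → Bool) → List ℕ → ℕ
count p xs = length (filter (λ x → Data.Bool.T? (p x)) xs)
  where import Data.Bool

ω : Partition → ℕ
ω μ = count (λ x → x ≡ᵇ 1) μ

largest : Partition → ℕ
largest = foldr Data.Nat._⊔_ 0
  where import Data.Nat

crank : Partition → ℤ
crank μ with ω μ
... | zero    = + largest μ
... | suc w   = + count (λ x → suc w <ᵇ x) μ ℤ.- + suc w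

isOne : Partition → Bool
isOne (1 ∷ []) = true
isOne _        = false

c : ℤ → Partition → ℤ
c m μ with isOne μ
... | true  = if ⌊ m ℤ.≟ + 1 ⌋ ∨ ⌊ m ℤ.≟ ℤ.- + 1 ⌋ then + 1
              else if ⌊ m ℤ.≟ + 0 ⌋ then ℤ.- + 1 else + 0
  where open import Relation.Nullary.Decidable using (⌊_⌋)
        open import Data.Bool using (_∨_)
... | false = if ⌊ crank μ ℤ.≟ m ⌋ then + 1 else + 0
  where open import Relation.Nullary.Decidable using (⌊_⌋)

residual : (d : ℕ) → .{{NonZero d}} → Overpartition → Partition
residual d [] = []
residual d ((p , true) ∷ λ₀) = residual d λ₀
residual d ((p , false) ∷ λ₀) =
  if p % d ≡ᵇ 0 then (p / d) ∷ residual d λ₀ else residual d λ₀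

sumℤ : List ℤ → ℤ
sumℤ = foldr ℤ._+_ (+ 0)

Mbar : (d : ℕ) → .{{NonZero d}} → ℤ → ℕ → ℤ
Mbar d m n = sumℤ (map (λ λ₀ → c m (residual d λ₀)) (overpartitions n))

-- k-th positive moment: Σ_{m ≥ 1} m^k Mbar d m n.  Only m ∈ [1, n] can
-- contribute (cranks of λ' are bounded by n), so the sum is taken over
-- m = 1, …, n.
Mplus : (d : ℕ) → .{{NonZero d}} → ℕ → ℕ → ℤ
Mplus d k n = sumℤ (map (λ i → (+ suc i) ℤ.^ k ℤ.* Mbar d (+ suc i) n) (upTo n))

-- For m ≥ 1 every weight c_m is nonnegative (only c₀((1)) = -1 is negative), so M̄[d](m,n) ≥ 0
-- and each term m^k M̄[d](m,n) of the k-th moment is at most m^(k+1) M̄[d](m,n), with equality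
-- when m = 1 or M̄[d](m,n) = 0.  If n < 2d, the residual partition λ' of an overpartition of n
-- satisfies d |λ'| ≤ n, so λ' is empty or (1), and c_m(λ') = 0 for m ≥ 2.  If n ≥ 2d, the
-- overpartition made of ⌊n/2d⌋ non-overlined parts 2d followed by the overlined part n mod 2d
-- has λ' = (2,…,2) of crank 2, so M̄[d](2,n) > 0 and the inequality is strict at m = 2.

module Submission where

open import Defs
open import Data.Nat using (ℕ; suc; _*_; _<_; _≤_; NonZero)
open import Data.Integer using (ℤ) renaming (_≤_ to _≤ℤ_)
open import Data.Product using (_×_)
open import Relation.Binary.PropositionalEquality using (_≡_)
open import Function.Bundles using (_⇔_; mk⇔)

open import Data.Bool using (true; false; if_then_else_; T)
open import Data.Empty using (⊥-elim)
open import Data.Integer as ℤ using (+_; 0ℤ; +≤+; +<+)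
import Data.Integer.Properties as ℤ
open import Data.List using (List; []; _∷_; _++_; map; concatMap; replicate; upTo)
open import Data.List.Membership.Propositional using (_∈_; find)
open import Data.List.Membership.Propositional.Properties
  using (∈-concatMap⁺; ∈-concatMap⁻; ∈-map⁺; ∈-map⁻; ∈-upTo⁺)
open import Data.List.Properties using (map-++; ++-identityʳ)
open import Data.List.Relation.Unary.All using (All; []; _∷_)
open import Data.List.Relation.Unary.All.Properties using (++⁺)
open import Data.List.Relation.Unary.Any as Any using (here; there)
open import Data.Nat as ℕ using (zero; _+_; _∸_; _≡ᵇ_; _≤′_; ≤′-refl; ≤′-step; z≤n; s≤s)
open import Data.Nat.DivMod
  using (_/_; _%_; m≡m%n+[m/n]*n; m/n*n≤m; m%n<n; m/n*n≡m; m*n%n≡0; m*n/n≡m; m≥n⇒m/n>0)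
open import Data.Nat.Divisibility using (m%n≡0⇒n∣m)
open import Data.Nat.ListAction using (sum)
open import Data.Nat.ListAction.Properties using (sum-++)
import Data.Nat.Properties as ℕ
open import Data.Product using (_,_; proj₁)
open import Data.Sum using (_⊎_; inj₁; inj₂)
open import Data.Unit using (tt)
open import Function using (_∘_)
open import Relation.Binary.PropositionalEquality
  using (refl; sym; trans; cong; cong₂; subst; module ≡-Reasoning)
open import Relation.Nullary using (yes; no)

module _ {a} {A : Set a} where

  sumℤ-map-mono : ∀ {f g : A → ℤ} xs → (∀ {x} → x ∈ xs → f x ≤ℤ g x) →
                  sumℤ (map f xs) ≤ℤ sumℤ (map g xs)
  sumℤ-map-mono []       f≤g = ℤ.≤-refl
  sumℤ-map-mono (x ∷ xs) f≤g = ℤ.+-mono-≤ (f≤g (here refl)) (sumℤ-map-mono xs (f≤g ∘ there))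

  sumℤ-map-< : ∀ {f g : A → ℤ} {y} xs → (∀ {x} → x ∈ xs → f x ≤ℤ g x) →
               y ∈ xs → f y ℤ.< g y → sumℤ (map f xs) ℤ.< sumℤ (map g xs)
  sumℤ-map-< (x ∷ xs) f≤g (here refl) fy<gy =
    ℤ.+-mono-<-≤ fy<gy (sumℤ-map-mono xs (f≤g ∘ there))
  sumℤ-map-< (x ∷ xs) f≤g (there y∈xs) fy<gy =
    ℤ.+-mono-≤-< (f≤g (here refl)) (sumℤ-map-< xs (f≤g ∘ there) y∈xs fy<gy)

  sumℤ-map-cong : ∀ {f g : A → ℤ} xs → (∀ {x} → x ∈ xs → f x ≡ g x) →
                  sumℤ (map f xs) ≡ sumℤ (map g xs)
  sumℤ-map-cong []       f≡g = refl
  sumℤ-map-cong (x ∷ xs) f≡g = cong₂ ℤ._+_ (f≡g (here refl)) (sumℤ-map-cong xs (f≡g ∘ there))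

  sumℤ-map-0 : ∀ (xs : List A) → sumℤ (map (λ _ → 0ℤ) xs) ≡ 0ℤ
  sumℤ-map-0 []       = refl
  sumℤ-map-0 (x ∷ xs) = trans (ℤ.+-identityˡ _) (sumℤ-map-0 xs)

pos-^-* : ∀ a k m → (+ a) ℤ.^ k ℤ.* + m ≡ + (a ℕ.^ k * m)
pos-^-* a zero    m = trans (ℤ.*-identityˡ (+ m)) (cong +_ (sym (ℕ.+-identityʳ m)))
pos-^-* a (suc k) m = begin
  (+ a ℤ.* (+ a) ℤ.^ k) ℤ.* + m  ≡⟨ ℤ.*-assoc (+ a) ((+ a) ℤ.^ k) (+ m) ⟩
  + a ℤ.* ((+ a) ℤ.^ k ℤ.* + m)  ≡⟨ cong (+ a ℤ.*_) (pos-^-* a k m) ⟩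
  + a ℤ.* + (a ℕ.^ k * m)        ≡⟨ sym (ℤ.pos-* a (a ℕ.^ k * m)) ⟩
  + (a * (a ℕ.^ k * m))          ≡⟨ cong +_ (sym (ℕ.*-assoc a (a ℕ.^ k) m)) ⟩
  + (a ℕ.^ suc k * m)            ∎
  where open ≡-Reasoning

^-suc-*-mono : ∀ a k {M} → 0ℤ ≤ℤ M → (+ suc a) ℤ.^ k ℤ.* M ≤ℤ (+ suc a) ℤ.^ suc k ℤ.* M
^-suc-*-mono a k {+ m} (+≤+ _)
  rewrite pos-^-* (suc a) k m | pos-^-* (suc a) (suc k) m =
  +≤+ (ℕ.*-monoˡ-≤ m (ℕ.^-monoʳ-≤ (suc a) (ℕ.n≤1+n k)))

^-suc-*-< : ∀ a k {M} → 0ℤ ℤ.< M →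
            (+ suc (suc a)) ℤ.^ k ℤ.* M ℤ.< (+ suc (suc a)) ℤ.^ suc k ℤ.* M
^-suc-*-< a k {+ suc m} (+<+ _)
  rewrite pos-^-* (suc (suc a)) k (suc m) | pos-^-* (suc (suc a)) (suc k) (suc m) =
  +<+ (ℕ.*-monoˡ-< (suc m) (ℕ.^-monoʳ-< (suc (suc a)) (s≤s (s≤s z≤n)) (ℕ.n<1+n k)))

if-then-1-else-0-nonneg : ∀ b → 0ℤ ≤ℤ (if b then + 1 else + 0)
if-then-1-else-0-nonneg true  = +≤+ z≤n
if-then-1-else-0-nonneg false = ℤ.≤-refl

c-nonneg : ∀ m μ → 0ℤ ≤ℤ c (+ suc m) μ
c-nonneg m μ with isOne μ
c-nonneg zero    μ | true  = +≤+ z≤n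
c-nonneg (suc m) μ | true  = ℤ.≤-refl
c-nonneg m       μ | false = if-then-1-else-0-nonneg _

positive-sum<2 : ∀ μ → All (1 ≤_) μ → sum μ < 2 → μ ≡ [] ⊎ μ ≡ 1 ∷ []
positive-sum<2 []                 _              _                  = inj₁ refl
positive-sum<2 (zero ∷ μ)         (() ∷ _)       _
positive-sum<2 (1 ∷ [])           _              _                  = inj₂ refl
positive-sum<2 (1 ∷ x ∷ μ)        (_ ∷ 1≤x ∷ _) (s≤s (s≤s x+μ≤0)) =
  ⊥-elim (ℕ.<-irrefl refl (ℕ.≤-trans 1≤x (ℕ.≤-trans (ℕ.m≤m+n x (sum μ)) x+μ≤0)))
positive-sum<2 (suc (suc x) ∷ μ) _              (s≤s (s≤s ()))

c-of-positive-sum<2 : ∀ m μ → All (1 ≤_) μ → sum μ < 2 → c (+ suc (suc m)) μ ≡ 0ℤ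
c-of-positive-sum<2 m μ pos μ<2 with positive-sum<2 μ pos μ<2
... | inj₁ refl = refl
... | inj₂ refl = refl

crank-of-ω≡0 : ∀ μ → ω μ ≡ 0 → crank μ ≡ + largest μ
crank-of-ω≡0 μ ω≡0 with ω μ
crank-of-ω≡0 μ refl | zero = refl

ω-replicate-2 : ∀ q → ω (replicate q 2) ≡ 0
ω-replicate-2 zero    = refl
ω-replicate-2 (suc q) = ω-replicate-2 q

largest-replicate-2 : ∀ q → largest (replicate (suc q) 2) ≡ 2
largest-replicate-2 zero    = refl
largest-replicate-2 (suc q) = cong (2 ℕ.⊔_) (largest-replicate-2 q)

c-2-replicate-2 : ∀ {j} → 0 < j → c (+ 2) (replicate j 2) ≡ + 1
c-2-replicate-2 {suc q} _
  rewrite crank-of-ω≡0 (replicate (suc q) 2) (ω-replicate-2 (suc q))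
        | largest-replicate-2 q
  = refl

weight : Overpartition → ℕ
weight π = sum (map proj₁ π)

weight-++ : ∀ π ρ → weight (π ++ ρ) ≡ weight π + weight ρ
weight-++ π ρ = trans (cong sum (map-++ proj₁ π ρ)) (sum-++ (map proj₁ π) (map proj₁ ρ))

weight-replicate : ∀ j p o → weight (replicate j (p , o)) ≡ j * p
weight-replicate zero    p o = refl
weight-replicate (suc j) p o = cong (p ℕ.+_) (weight-replicate j p o)

PositiveParts : Overpartition → Set
PositiveParts = All ((1 ≤_) ∘ proj₁)

replicate-positive : ∀ j p o → PositiveParts (replicate j (suc p , o))
replicate-positive zero    p o = []
replicate-positive (suc j) p o = s≤s z≤n ∷ replicate-positive j p o

module _ {a} {A : Set a} {x : A} {xs : List A} where

  ∈-if⁺ : ∀ b → T b → x ∈ xs → x ∈ (if b then xs else [])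
  ∈-if⁺ true _ x∈xs = x∈xs

  ∈-if⁻ : ∀ b → x ∈ (if b then xs else []) → T b × x ∈ xs
  ∈-if⁻ true x∈xs = tt , x∈xs

∈-blocks⁻ : ∀ {p j b} → b ∈ blocks (suc p) j → PositiveParts b × weight b ≡ j * suc p
∈-blocks⁻ {p} {zero}  (here refl)         = [] , refl
∈-blocks⁻ {p} {suc j} (here refl)         =
  s≤s z≤n ∷ replicate-positive j p false , cong (suc p ℕ.+_) (weight-replicate j (suc p) false)
∈-blocks⁻ {p} {suc j} (there (here refl)) =
  replicate-positive (suc j) p false , weight-replicate (suc j) (suc p) false

replicate-∈-blocks : ∀ p j → replicate j (p , false) ∈ blocks p j
replicate-∈-blocks p zero    = here refl
replicate-∈-blocks p (suc j) = there (here refl)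

data Split (n s : ℕ) : Overpartition → Set where
  split : ∀ {j b ρ} → j * suc s ≤ n → b ∈ blocks (suc s) j →
          ρ ∈ overpartitionsMax (n ∸ j * suc s) s → Split n s (b ++ ρ)

∈-overpartitionsMax-suc⁺ : ∀ {n s π} → Split n s π → π ∈ overpartitionsMax n (suc s)
∈-overpartitionsMax-suc⁺ {n} {s} (split {j} {b} {ρ} js≤n b∈ ρ∈) =
  ∈-concatMap⁺ _ (Any.map (λ { refl → ∈-if⁺ _ (ℕ.≤⇒≤ᵇ js≤n) ∈-j-blocks }) (∈-upTo⁺ j<1+n))
  where
  j<1+n : j < suc n
  j<1+n = s≤s (ℕ.≤-trans (ℕ.m≤m*n j (suc s)) js≤n)
  ∈-j-blocks : b ++ ρ ∈ concatMap (λ b′ → map (b′ ++_) (overpartitionsMax (n ∸ j * suc s) s))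
                                  (blocks (suc s) j)
  ∈-j-blocks = ∈-concatMap⁺ _ (Any.map (λ { refl → ∈-map⁺ (b ++_) ρ∈ }) b∈)

∈-overpartitionsMax-suc⁻ : ∀ {n s π} → π ∈ overpartitionsMax n (suc s) → Split n s π
∈-overpartitionsMax-suc⁻ {n} {s} π∈
  with j , π∈j ← Any.satisfied (∈-concatMap⁻ _ {xs = upTo (suc n)} π∈)
  with js≤ᵇn , π∈blocks ← ∈-if⁻ (j * suc s ℕ.≤ᵇ n) π∈j
  with b , b∈ , π∈b ← find (∈-concatMap⁻ _ {xs = blocks (suc s) j} π∈blocks)
  with ρ , ρ∈ , refl ← ∈-map⁻ (b ++_) π∈b
  = split (ℕ.≤ᵇ⇒≤ (j * suc s) n js≤ᵇn) b∈ ρ∈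

∈-overpartitionsMax⁻ : ∀ n s {π} → π ∈ overpartitionsMax n s →
                       PositiveParts π × weight π ≡ n
∈-overpartitionsMax⁻ zero    zero    (here refl) = [] , refl
∈-overpartitionsMax⁻ n       (suc s) π∈ with ∈-overpartitionsMax-suc⁻ π∈
... | split {j} {b} {ρ} js≤n b∈ ρ∈
  with b-pos , b-weight ← ∈-blocks⁻ b∈
  with ρ-pos , ρ-weight ← ∈-overpartitionsMax⁻ (n ∸ j * suc s) s ρ∈
  = ++⁺ b-pos ρ-pos , (begin
    weight (b ++ ρ)                ≡⟨ weight-++ b ρ ⟩
    weight b + weight ρ            ≡⟨ cong₂ _+_ b-weight ρ-weight ⟩
    j * suc s + (n ∸ j * suc s)    ≡⟨ ℕ.m+[n∸m]≡n js≤n ⟩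
    n                              ∎)
  where open ≡-Reasoning

overpartitionsMax-mono : ∀ {n s t π} → s ≤′ t →
                         π ∈ overpartitionsMax n s → π ∈ overpartitionsMax n t
overpartitionsMax-mono     ≤′-refl           π∈ = π∈
overpartitionsMax-mono {n} (≤′-step {t} s≤t) π∈ =
  ∈-overpartitionsMax-suc⁺ {n} {t} (split {j = 0} z≤n (here refl) (overpartitionsMax-mono s≤t π∈))

[]-∈-overpartitionsMax : ∀ s → [] ∈ overpartitionsMax 0 s
[]-∈-overpartitionsMax s = overpartitionsMax-mono {0} {0} {s} (ℕ.≤⇒≤′ z≤n) (here refl)

overlinedPart : ℕ → Overpartition
overlinedPart zero    = []
overlinedPart (suc r) = (suc r , true) ∷ []

overlinedPart-∈ : ∀ {r s} → r ≤ s → overlinedPart r ∈ overpartitionsMax r s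
overlinedPart-∈ {zero} {s} _ = []-∈-overpartitionsMax s
overlinedPart-∈ {suc r} r<s = overpartitionsMax-mono (ℕ.≤⇒≤′ r<s)
  (∈-overpartitionsMax-suc⁺ (split {j = 1} (ℕ.≤-reflexive 1*r≡r) (here refl)
    (subst (λ m → [] ∈ overpartitionsMax m r) (sym r∸1*r≡0) ([]-∈-overpartitionsMax r))))
  where
  1*r≡r : 1 * suc r ≡ suc r
  1*r≡r = ℕ.*-identityˡ (suc r)
  r∸1*r≡0 : suc r ∸ 1 * suc r ≡ 0
  r∸1*r≡0 = trans (cong (suc r ∸_) 1*r≡r) (ℕ.n∸n≡0 (suc r))

copiesWithRemainder : (p : ℕ) → .{{NonZero p}} → ℕ → Overpartition
copiesWithRemainder p n = replicate (n / p) (p , false) ++ overlinedPart (n % p)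

copiesWithRemainder-∈ : ∀ p .{{_ : NonZero p}} n {s} → p ≤ s →
                        copiesWithRemainder p n ∈ overpartitionsMax n s
copiesWithRemainder-∈ p@(suc e) n p≤s = overpartitionsMax-mono (ℕ.≤⇒≤′ p≤s)
  (∈-overpartitionsMax-suc⁺ (split {j = n / p} (m/n*n≤m n p) (replicate-∈-blocks p (n / p))
    (subst (λ m → overlinedPart (n % p) ∈ overpartitionsMax m e) (sym n∸q*p≡r)
      (overlinedPart-∈ (ℕ.≤-pred (m%n<n n p))))))
  where
  open ≡-Reasoning
  n∸q*p≡r : n ∸ n / p * p ≡ n % p
  n∸q*p≡r = begin
    n ∸ n / p * p                  ≡⟨ cong (_∸ n / p * p) (m≡m%n+[m/n]*n n p) ⟩
    n % p + n / p * p ∸ n / p * p  ≡⟨ ℕ.m+n∸n≡m (n % p) (n / p * p) ⟩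
    n % p                          ∎

module _ (d : ℕ) .{{_ : NonZero d}} where

  residual-++ : ∀ π ρ → residual d (π ++ ρ) ≡ residual d π ++ residual d ρ
  residual-++ []                ρ = refl
  residual-++ ((p , true)  ∷ π) ρ = residual-++ π ρ
  residual-++ ((p , false) ∷ π) ρ with p % d ≡ᵇ 0
  ... | true  = cong (p / d ∷_) (residual-++ π ρ)
  ... | false = residual-++ π ρ

  residual-overlinedPart : ∀ r → residual d (overlinedPart r) ≡ []
  residual-overlinedPart zero    = refl
  residual-overlinedPart (suc r) = refl

  residual-divisible : ∀ p π → p % d ≡ 0 → residual d ((p , false) ∷ π) ≡ p / d ∷ residual d π
  residual-divisible p π p%d≡0 rewrite p%d≡0 = refl

  residual-replicate : ∀ j q → residual d (replicate j (q * d , false)) ≡ replicate j q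
  residual-replicate zero    q = refl
  residual-replicate (suc j) q =
    trans (residual-divisible (q * d) (replicate j (q * d , false)) (m*n%n≡0 q d))
          (cong₂ _∷_ (m*n/n≡m q d) (residual-replicate j q))

  quotient-positive : ∀ {p} → 1 ≤ p → p / d * d ≡ p → 1 ≤ p / d
  quotient-positive {p} 1≤p q*d≡p with p / d
  ... | zero  = ⊥-elim (ℕ.<-irrefl refl (subst (1 ≤_) (sym q*d≡p) 1≤p))
  ... | suc q = s≤s z≤n

  residual-bound : ∀ π → PositiveParts π →
                   All (1 ≤_) (residual d π) × sum (residual d π) * d ≤ weight π
  residual-bound []                []           = [] , z≤n
  residual-bound ((p , true)  ∷ π) (_ ∷ pos)
    with rest-pos , rest≤ ← residual-bound π pos
    = rest-pos , ℕ.≤-trans rest≤ (ℕ.m≤n+m (weight π) p)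
  residual-bound ((p , false) ∷ π) (1≤p ∷ pos) with p % d ≡ᵇ 0 in p%d≡ᵇ0 | residual-bound π pos
  ... | false | rest-pos , rest≤ = rest-pos , ℕ.≤-trans rest≤ (ℕ.m≤n+m (weight π) p)
  ... | true  | rest-pos , rest≤ = quotient-positive 1≤p q*d≡p ∷ rest-pos , (begin
    (p / d + sum (residual d π)) * d    ≡⟨ ℕ.*-distribʳ-+ d (p / d) (sum (residual d π)) ⟩
    p / d * d + sum (residual d π) * d  ≤⟨ ℕ.+-mono-≤ (ℕ.≤-reflexive q*d≡p) rest≤ ⟩
    p + weight π                        ∎)
    where
    open ℕ.≤-Reasoning
    q*d≡p : p / d * d ≡ p
    q*d≡p = m/n*n≡m (m%n≡0⇒n∣m p d (ℕ.≡ᵇ⇒≡ (p % d) 0 (subst T (sym p%d≡ᵇ0) tt)))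

  c-residual-vanishes : ∀ m {n π} → n < 2 * d → π ∈ overpartitions n →
                        c (+ suc (suc m)) (residual d π) ≡ 0ℤ
  c-residual-vanishes m {n} {π} n<2d π∈
    with pos , weight≡n ← ∈-overpartitionsMax⁻ n n π∈
    with res-pos , res≤ ← residual-bound π pos
    = c-of-positive-sum<2 m (residual d π) res-pos
        (ℕ.*-cancelʳ-< d _ 2 (ℕ.≤-<-trans (ℕ.≤-trans res≤ (ℕ.≤-reflexive weight≡n)) n<2d))

  residual-copies : ∀ q .{{_ : NonZero (q * d)}} n →
                    residual d (copiesWithRemainder (q * d) n) ≡ replicate (n / (q * d)) q
  residual-copies q n = begin
    residual d (copies ++ overlinedPart r)            ≡⟨ residual-++ copies (overlinedPart r) ⟩
    residual d copies ++ residual d (overlinedPart r)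
      ≡⟨ cong₂ _++_ (residual-replicate j q) (residual-overlinedPart r) ⟩
    replicate j q ++ []                               ≡⟨ ++-identityʳ (replicate j q) ⟩
    replicate j q                                     ∎
    where
    open ≡-Reasoning
    j r : ℕ
    j = n / (q * d)
    r = n % (q * d)
    copies : Overpartition
    copies = replicate j (q * d , false)

  instance
    2d≢0 : NonZero (2 * d)
    2d≢0 = ℕ.m*n≢0 2 d

  c-2-residual-copies : ∀ {n} → 2 * d ≤ n →
                        c (+ 2) (residual d (copiesWithRemainder (2 * d) n)) ≡ + 1
  c-2-residual-copies {n} 2d≤n =
    trans (cong (c (+ 2)) (residual-copies 2 n)) (c-2-replicate-2 (m≥n⇒m/n>0 2d≤n))

  Mbar-nonneg : ∀ m n → 0ℤ ≤ℤ Mbar d (+ suc m) n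
  Mbar-nonneg m n = subst (_≤ℤ Mbar d (+ suc m) n) (sumℤ-map-0 (overpartitions n))
    (sumℤ-map-mono (overpartitions n) (λ {π} _ → c-nonneg m (residual d π)))

  Mbar-vanishes : ∀ m {n} → n < 2 * d → Mbar d (+ suc (suc m)) n ≡ 0ℤ
  Mbar-vanishes m {n} n<2d = trans (sumℤ-map-cong (overpartitions n) (c-residual-vanishes m n<2d))
                                   (sumℤ-map-0 (overpartitions n))

  Mbar-2-positive : ∀ {n} → 2 * d ≤ n → 0ℤ ℤ.< Mbar d (+ 2) n
  Mbar-2-positive {n} 2d≤n = subst (ℤ._< Mbar d (+ 2) n) (sumℤ-map-0 (overpartitions n))
    (sumℤ-map-< (overpartitions n) (λ {π} _ → c-nonneg 1 (residual d π))
      (copiesWithRemainder-∈ (2 * d) n 2d≤n)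
      (subst (0ℤ ℤ.<_) (sym (c-2-residual-copies 2d≤n)) (+<+ (s≤s z≤n))))

  momentTerm : ℕ → ℕ → ℕ → ℤ
  momentTerm k n i = (+ suc i) ℤ.^ k ℤ.* Mbar d (+ suc i) n

  momentTerm-mono : ∀ k n i → momentTerm k n i ≤ℤ momentTerm (suc k) n i
  momentTerm-mono k n i = ^-suc-*-mono i k (Mbar-nonneg i n)

  momentTerm-≡ : ∀ k {n} i → n < 2 * d → momentTerm k n i ≡ momentTerm (suc k) n i
  momentTerm-≡ k {n} zero _ =
    cong (ℤ._* Mbar d (+ 1) n) (trans (ℤ.^-zeroˡ k) (sym (ℤ.^-zeroˡ (suc k))))
  momentTerm-≡ k {n} (suc i) n<2d rewrite Mbar-vanishes i n<2d =
    trans (ℤ.*-zeroʳ ((+ suc (suc i)) ℤ.^ k)) (sym (ℤ.*-zeroʳ ((+ suc (suc i)) ℤ.^ suc k)))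

  Mplus-mono : ∀ k n → Mplus d k n ≤ℤ Mplus d (suc k) n
  Mplus-mono k n = sumℤ-map-mono (upTo n) (λ {i} _ → momentTerm-mono k n i)

  Mplus-< : ∀ k {n} → 2 * d ≤ n → Mplus d k n ℤ.< Mplus d (suc k) n
  Mplus-< k {n} 2d≤n = sumℤ-map-< (upTo n) (λ {i} _ → momentTerm-mono k n i) (∈-upTo⁺ 1<n)
                                  (^-suc-*-< 0 k (Mbar-2-positive 2d≤n))
    where
    1<n : 1 < n
    1<n = ℕ.≤-trans (ℕ.*-monoʳ-≤ 2 (ℕ.>-nonZero⁻¹ d)) 2d≤n

  Mplus-≡ : ∀ k {n} → n < 2 * d → Mplus d k n ≡ Mplus d (suc k) n
  Mplus-≡ k {n} n<2d = sumℤ-map-cong (upTo n) (λ {i} _ → momentTerm-≡ k i n<2d)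

-- The inequality and its equality case hold for k = 0 as well.
theorem2 : (d k n : ℕ) → .{{_ : NonZero d}} → 1 ≤ k →
    (Mplus d k n ≤ℤ Mplus d (suc k) n) × ((Mplus d k n ≡ Mplus d (suc k) n) ⇔ (n < 2 * d))
theorem2 d k n _ = Mplus-mono d k n , mk⇔ equal⇒small (Mplus-≡ d k)
  where
  equal⇒small : Mplus d k n ≡ Mplus d (suc k) n → n < 2 * d
  equal⇒small eq with n ℕ.<? 2 * d
  ... | yes n<2d = n<2d
  ... | no  n≮2d = ⊥-elim (ℤ.<⇒≢ (Mplus-< d k (ℕ.≮⇒≥ n≮2d)) eq)
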